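{- Let $A$ be the following deterministic online algorithm with a buffer of size $4M$: it reads elements until its buffer is full; then, repeatedly at each decision point, it uses its buffer contents to determine which of the maximal increasing run and the maximal decreasing run that an algorithm with buffer size $M$ would write next on the current unwritten-element sequence is longer, and then, using its full $4M$-size buffer, writes a maximal run in that direction (increasing if the $M$-buffer maximal increasing run is longer, otherwise decreasing); it stops when no elements are left. Then for every input $I$ with no duplicate elements, $A$ writes no more runs than $\mathrm{OPT}_M(I)$, the optimal number of runs for an algorithm with buffer size $M$.
   Context: Up-down run generation problem: an input stream $I$ of elements from a totally ordered set is presented in order to an algorithm with a buffer of $B$ slots; the algorithm reads elements in order into the buffer and writes elements from the buffer to an output sequence, each write freeing a slot that is filled by the next input element. A run is a sorted or reverse-sorted sequence; the number of runs of an output $S$ is the smallest $k$ such that $S$ is a concatenation of $k$ runs. $\mathrm{OPT}_M(I)$ is the minimum number of runs of any output achievable on $I$ with buffer size $M$. A maximal increasing run (for a given buffer) is written by starting with the smallest buffered element, always writing the smallest buffered element larger than the last element written, and ending only when every buffered element is smaller than the last written; maximal decreasing runs are symmetric. The unwritten-element sequence is the buffer contents (in arrival order) followed by the unread input. A decision point is the start or any time a run has just ended. -}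

module Defs where

open import Level using (_⊔_)
open import Data.Bool using (Bool; true; false; if_then_else_; _∧_; not)
open import Data.Nat using (ℕ; zero; suc; _*_; _<ᵇ_; _≤_)
open import Data.Product using (_×_; _,_; Σ; ∃; proj₁)
open import Data.Maybe using (Maybe; just; nothing)
open import Data.List using (List; []; _∷_; _++_; take; drop; length; concat)
open import Data.List.Membership.Propositional using (_∈_)
open import Data.List.Relation.Unary.Any using (_─_)
open import Data.List.Relation.Unary.All using (All)
open import Data.List.Relation.Unary.Linked using (Linked)
open import Data.Sum using (_⊎_)
open import Relation.Nullary.Decidable using (isYes)
open import Relation.Binary.PropositionalEquality using (_≡_)
open import Relation.Binary.Bundles using (StrictTotalOrder)

module _ {a ℓ₁ ℓ₂} (O : StrictTotalOrder a ℓ₁ ℓ₂) where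

  open StrictTotalOrder O renaming (Carrier to A)

  Ascending : List A → Set (a ⊔ ℓ₁ ⊔ ℓ₂)
  Ascending = Linked (λ x y → x < y ⊎ x ≈ y)

  Descending : List A → Set (a ⊔ ℓ₁ ⊔ ℓ₂)
  Descending = Linked (λ x y → y < x ⊎ y ≈ x)

  IsRun : List A → Set (a ⊔ ℓ₁ ⊔ ℓ₂)
  IsRun S = Ascending S ⊎ Descending S

  SplitsInto : ℕ → List A → Set (a ⊔ ℓ₁ ⊔ ℓ₂)
  SplitsInto k S = Σ (List (List A)) λ Ls →
    (length Ls ≡ k) × (concat Ls ≡ S) × All IsRun Ls

  -- State: buffer contents (in arrival order) and unread input.
  -- Exec buf rest out : starting from this state, some algorithm can
  -- write exactly the output `out` (writing every element).

  data Exec : List A → List A → List A → Set a where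
    done  : Exec [] [] []
    write : ∀ {buf rest out x} (x∈buf : x ∈ buf) →
            Exec ((buf ─ x∈buf) ++ take 1 rest) (drop 1 rest) out →
            Exec buf rest (x ∷ out)

  Achievable : ℕ → List A → List A → Set a
  Achievable M I S = Exec (take M I) (drop M I) S

  -- OPT_M(I) ≥ n  (i.e. n is at most the minimum number of runs of any
  -- achievable output with buffer size M)
  _≤OPT[_]_ : ℕ → ℕ → List A → Set (a ⊔ ℓ₁ ⊔ ℓ₂)
  n ≤OPT[ M ] I = ∀ S → Achievable M I S → ∀ k → SplitsInto k S → n ≤ k

  data Dir : Set where
    up down : Dir

  before : Dir → A → A → Bool
  before up   x y = isYes (x <? y)
  before down x y = isYes (y <? x)

  extract : Dir → (A → Bool) → List A → Maybe (A × List A)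
  extract d p [] = nothing
  extract d p (x ∷ xs) = go (extract d p xs)
    where
    go : Maybe (A × List A) → Maybe (A × List A)
    go nothing        = if p x then just (x , xs) else nothing
    go (just (y , ys)) =
      if p x ∧ not (before d y x) then just (x , xs) else just (y , x ∷ ys)

  eligible : Dir → Maybe A → A → Bool
  eligible d nothing  x = true
  eligible d (just l) x = before d l x

  -- The fuel argument is only a termination device; fuel ≥ number of
  -- unwritten elements is always enough.
  runFrom : ℕ → Dir → Maybe A → List A → List A → List A × List A × List A
  runFrom zero    d last buf rest = [] , buf , rest
  runFrom (suc n) d last buf rest = go (extract d (eligible d last) buf)
    where
    go : Maybe (A × List A) → List A × List A × List A
    go nothing = [] , buf , rest
    go (just (x , buf')) with runFrom n d (just x) (buf' ++ take 1 rest) (drop 1 rest)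
    ... | w , b , r = x ∷ w , b , r

  maxRun : Dir → ℕ → List A → List A
  maxRun d B U = proj₁ (runFrom (length U) d nothing (take B U) (drop B U))

  chooseDir : ℕ → List A → Dir
  chooseDir M U =
    if length (maxRun down M U) <ᵇ length (maxRun up M U) then up else down

  algLoop : ℕ → ℕ → List A → List A → List (List A)
  algLoop M zero    buf        rest = []
  algLoop M (suc n) []         rest = []
  algLoop M (suc n) (b ∷ buf)  rest
    with runFrom (length ((b ∷ buf) ++ rest)) (chooseDir M ((b ∷ buf) ++ rest))
                 nothing (b ∷ buf) rest
  ... | w , buf' , rest' = w ∷ algLoop M n buf' rest'

  -- runs written by A on input I (fuel length I + 1 suffices: every
  -- phase with a nonempty buffer writes at least one element)
  runsOfA : ℕ → List A → List (List A)
  runsOfA M I = algLoop M (suc (length I)) (take (4 * M) I) (drop (4 * M) I)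

-- A maximal run with a larger buffer writes every sequence in its direction that an
-- M-buffer algorithm could write from the same state. So if the first run R of an optimal
-- M-buffer output goes in A's direction d, A's first run contains R. If R goes against d,
-- it is no longer than the M-buffer maximal run against d, hence than the one along d.
-- Two runs in opposite directions, both writable with M slots and the one along d the
-- longer, share an element among their first M unless |R| < M; this pins |R| ≤ 3M, so R
-- lies among the first 4M unwritten elements, all of which A's first run writes. Either way A leaves
-- unwritten a subsequence of what the optimum leaves, deleting elements does not increase
-- the optimum, and induction on the number of runs concludes.
module Submission where

open import Defs
open import Level using (Level; _⊔_)
open import Data.Bool using (Bool; true; false; T; if_then_else_; _∧_; not)
open import Data.Bool.Properties using (not-¬)
open import Data.Nat using (ℕ; zero; suc; _+_; _*_; _∸_; _≤_; _<_; z≤n; s≤s; _<ᵇ_)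
import Data.Nat.Properties as ℕ
open import Data.Fin using (toℕ)
open import Data.List using (List; []; _∷_; _++_; take; drop; concat; length; filter)
open import Data.List.Properties
  using (take++drop≡id; length-++; length-removeAt′; take-[]; length-take; length-drop)
open import Data.List.Relation.Unary.Any as Any using (Any; here; there; _─_; index)
open import Data.List.Relation.Unary.All as All using (All; []; _∷_)
open import Data.List.Relation.Unary.All.Properties using (++⁺)
open import Data.List.Relation.Unary.Any.Properties as AnyP using (¬Any[])
open import Data.List.Relation.Unary.Linked using (Linked; []; [-]; _∷_)
open import Data.List.Relation.Unary.Linked.Properties using (Linked⇒AllPairs; AllPairs⇒Linked)
open import Data.List.Relation.Unary.AllPairs as AllPairs using (AllPairs; []; _∷_)
open import Data.List.Relation.Unary.Unique.Setoid using (Unique)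
open import Data.List.Membership.Propositional using (_∈_; find; lose)
open import Data.List.Membership.Setoid.Properties using (∈-resp-≈)
import Data.List.Relation.Unary.Unique.Setoid.Properties as Unique
open import Data.List.Membership.Propositional.Properties using (∈-filter⁺; ∈-filter⁻)
open import Data.List.Relation.Binary.Sublist.Propositional using (_⊆_; []; _∷_; _∷ʳ_; ⊆-refl; ⊆-trans)
open import Data.List.Relation.Binary.Sublist.Propositional.Properties
  using (take-⊆; drop-⊆; All-resp-⊆; Any-resp-⊆; length-mono-≤)
import Data.List.Relation.Binary.Sublist.Heterogeneous.Properties as HP
open import Data.Product using (∃; ∃₂; _×_; _,_; proj₁; proj₂)
open import Data.Sum using (_⊎_; inj₁; inj₂)
open import Data.Empty using (⊥; ⊥-elim)
open import Data.Maybe using (Maybe; just; nothing)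
open import Relation.Nullary using (¬_; yes; no)
open import Relation.Binary.PropositionalEquality using (_≡_; refl; sym; trans; cong; cong₂; subst; _≢_)
open import Relation.Binary.Definitions using (tri<; tri≈; tri>)
open import Relation.Binary.Bundles using (StrictTotalOrder)
open import Function using (_∘_; flip; case_of_)
import Relation.Binary.Construct.StrictToNonStrict as StrictToNonStrict

module UpDownRuns {a ℓ₁ ℓ₂} (O : StrictTotalOrder a ℓ₁ ℓ₂) where
  open StrictTotalOrder O using (_≈_; compare)
    renaming (Carrier to A; _<_ to _⊏_; _<?_ to _⊏?_; module Eq to ≈)
  module < = StrictTotalOrder O
  module NonStrict = StrictToNonStrict _≈_ _⊏_

  private
    variable
      d : Dir O
      x y z : A
      n B M : ℕ
      last : Maybe A
      R S U U′ V W : List A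

  -- Directions and greedy extraction

  _≺[_]_ : A → Dir O → A → Set ℓ₂
  x ≺[ up ]   y = x ⊏ y
  x ≺[ down ] y = y ⊏ x

  opposite : Dir O → Dir O
  opposite up   = down
  opposite down = up

  ≺-opposite : ∀ d → x ≺[ opposite d ] y → y ≺[ d ] x
  ≺-opposite up   p = p
  ≺-opposite down p = p

  before-complete : ∀ d → x ≺[ d ] y → before O d x y ≡ true
  before-complete {x} {y} up p with x ⊏? y
  ... | yes _ = refl
  ... | no ¬p = ⊥-elim (¬p p)
  before-complete {x} {y} down p with y ⊏? x
  ... | yes _ = refl
  ... | no ¬p = ⊥-elim (¬p p)

  before-sound : ∀ d → before O d x y ≡ true → x ≺[ d ] y
  before-sound {x} {y} up e with x ⊏? y
  ... | yes p = p
  before-sound {x} {y} down e with y ⊏? x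
  ... | yes p = p

  before-false : ∀ d → before O d x y ≡ false → ¬ x ≺[ d ] y
  before-false d e p with () ← trans (sym e) (before-complete d p)

  ≺-trans : ∀ d → x ≺[ d ] y → y ≺[ d ] z → x ≺[ d ] z
  ≺-trans up   p q = <.trans p q
  ≺-trans down p q = <.trans q p

  ≺-irrefl : ∀ d → x ≺[ d ] y → ¬ x ≈ y
  ≺-irrefl up   p e = <.irrefl e p
  ≺-irrefl down p e = <.irrefl (≈.sym e) p

  ≺-asym : ∀ d → x ≺[ d ] y → ¬ y ≺[ d ] x
  ≺-asym d p q = ≺-irrefl d (≺-trans d p q) ≈.refl

  ≺-respˡ-≈ : ∀ d → x ≈ y → x ≺[ d ] z → y ≺[ d ] z
  ≺-respˡ-≈ up   e p = <.<-respˡ-≈ e p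
  ≺-respˡ-≈ down e p = <.<-respʳ-≈ e p

  ≺-respʳ-≈ : ∀ d → y ≈ z → x ≺[ d ] y → x ≺[ d ] z
  ≺-respʳ-≈ up   e p = <.<-respʳ-≈ e p
  ≺-respʳ-≈ down e p = <.<-respˡ-≈ e p

  ≺-trichotomous : ∀ d x y → x ≈ y ⊎ x ≺[ d ] y ⊎ y ≺[ d ] x
  ≺-trichotomous up x y with compare x y
  ... | tri< p _ _ = inj₂ (inj₁ p)
  ... | tri≈ _ e _ = inj₁ e
  ... | tri> _ _ p = inj₂ (inj₂ p)
  ≺-trichotomous down x y with compare x y
  ... | tri< p _ _ = inj₂ (inj₂ p)
  ... | tri≈ _ e _ = inj₁ e
  ... | tri> _ _ p = inj₂ (inj₁ p)

  ⊀-trans : ∀ d → ¬ x ≺[ d ] y → ¬ y ≺[ d ] z → ¬ x ≺[ d ] z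
  ⊀-trans {x} {y} d ¬xy ¬yz xz with ≺-trichotomous d x y
  ... | inj₁ e        = ¬yz (≺-respˡ-≈ d e xz)
  ... | inj₂ (inj₁ p) = ¬xy p
  ... | inj₂ (inj₂ p) = ¬yz (≺-trans d p xz)

  record Extraction (d : Dir O) (p : A → Bool) (xs : List A) (w : A) (ys : List A) : Set (a ⊔ ℓ₂) where
    field
      w∈xs     : w ∈ xs
      residue  : ys ≡ (xs ─ w∈xs)
      chosen-p : p w ≡ true
      best     : ∀ {y} → y ∈ xs → p y ≡ true → ¬ y ≺[ d ] w

  extend : Dir O → A → List A → Bool → Maybe (A × List A) → Maybe (A × List A)
  extend d x xs px nothing          = if px then just (x , xs) else nothing
  extend d x xs px (just (y , ys)) =
    if px ∧ not (before O d y x) then just (x , xs) else just (y , x ∷ ys)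

  extract-∷ : ∀ d p x xs → extract O d p (x ∷ xs) ≡ extend d x xs (p x) (extract O d p xs)
  extract-∷ d p x xs with extract O d p xs
  ... | nothing = refl
  ... | just _  = refl

  extract-nothing : ∀ d p xs → extract O d p xs ≡ nothing → y ∈ xs → p y ≡ false
  extract-nothing d p (x ∷ xs) e y∈
    with extract O d p xs in eq | p x in px | trans (sym (extract-∷ d p x xs)) e
  extract-nothing d p (x ∷ xs) e (here refl) | nothing | false | _ = px
  extract-nothing d p (x ∷ xs) e (there y∈) | nothing | false | _ = extract-nothing d p xs eq y∈
  ... | just (z , _) | true | e′ with before O d z x
  extract-nothing d p (x ∷ xs) e y∈ | just _ | true | () | true
  extract-nothing d p (x ∷ xs) e y∈ | just _ | true | () | false

  extract-just : ∀ d p xs {w ys} → extract O d p xs ≡ just (w , ys) → Extraction d p xs w ys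
  extract-just d p (x ∷ xs) e
    with extract O d p xs in eq | p x in px | trans (sym (extract-∷ d p x xs)) e
  ... | nothing | true | refl = record
    { w∈xs = here refl ; residue = refl ; chosen-p = px
    ; best = λ { (here refl) _ q → ≺-irrefl d q ≈.refl
               ; (there y∈) py → ⊥-elim (not-¬ (extract-nothing d p xs eq y∈) py) } }
  ... | just (z , zs) | _ | e′ with extract-just d p xs eq | before O d z x in zx
  extract-just d p (x ∷ xs) e | just _ | true | refl | r | false = record
    { w∈xs = here refl ; residue = refl ; chosen-p = px
    ; best = λ { (here refl) _ q → ≺-irrefl d q ≈.refl
               ; (there y∈) py → ⊀-trans d (best y∈ py) (before-false d zx) } }
    where open Extraction r
  extract-just d p (x ∷ xs) e | just _ | true | refl | r | true = record
    { w∈xs = there w∈xs ; residue = cong (x ∷_) residue ; chosen-p = chosen-p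
    ; best = λ { (here refl) _ → ≺-asym d (before-sound d zx)
               ; (there y∈) py → best y∈ py } }
    where open Extraction r
  extract-just d p (x ∷ xs) e | just _ | false | refl | r | _ = record
    { w∈xs = there w∈xs ; residue = cong (x ∷_) residue ; chosen-p = chosen-p
    ; best = λ { (here refl) py → ⊥-elim (not-¬ px py)
               ; (there y∈) py → best y∈ py } }
    where open Extraction r

  -- Unwritten-element sequences

  ∈-take⁻ : ∀ n (U : List A) → x ∈ take n U → x ∈ U
  ∈-take⁻ (suc n) (u ∷ U) (here p) = here p
  ∈-take⁻ (suc n) (u ∷ U) (there p) = there (∈-take⁻ n U p)

  index-∈-take⁻ : ∀ n (U : List A) (p : x ∈ take n U) → toℕ (index (∈-take⁻ n U p)) < n
  index-∈-take⁻ (suc n) (u ∷ U) (here p) = s≤s z≤n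
  index-∈-take⁻ (suc n) (u ∷ U) (there p) = s≤s (index-∈-take⁻ n U p)

  ∈-take⁺ : (p : x ∈ U) → toℕ (index p) < n → x ∈ take n U
  ∈-take⁺ {n = suc n} (here e) _ = here e
  ∈-take⁺ {n = suc n} (there p) (s≤s i<n) = there (∈-take⁺ p i<n)

  ∈-take-mono : ∀ {n m U} → n ≤ m → x ∈ take n U → x ∈ take m U
  ∈-take-mono {n = suc n} {suc m} {u ∷ U} _ (here e) = here e
  ∈-take-mono {n = suc n} {suc m} {u ∷ U} (s≤s n≤m) (there p) = there (∈-take-mono n≤m p)

  take-++-take-one : ∀ n (U : List A) → take n U ++ take 1 (drop n U) ≡ take (suc n) U
  take-++-take-one zero [] = refl
  take-++-take-one zero (u ∷ U) = refl
  take-++-take-one (suc n) [] = refl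
  take-++-take-one (suc n) (u ∷ U) = cong (u ∷_) (take-++-take-one n U)

  drop-one-drop : ∀ n (U : List A) → drop 1 (drop n U) ≡ drop (suc n) U
  drop-one-drop zero [] = refl
  drop-one-drop zero (u ∷ U) = refl
  drop-one-drop (suc n) [] = refl
  drop-one-drop (suc n) (u ∷ U) = drop-one-drop n U

  take-─ : ∀ n (U : List A) (p : x ∈ take n U) →
           (take n U ─ p) ++ take 1 (drop n U) ≡ take n (U ─ ∈-take⁻ n U p)
  take-─ (suc n) (u ∷ U) (here _) = take-++-take-one n U
  take-─ (suc n) (u ∷ U) (there p) = cong (u ∷_) (take-─ n U p)

  drop-─ : ∀ n (U : List A) (p : x ∈ take n U) → drop 1 (drop n U) ≡ drop n (U ─ ∈-take⁻ n U p)
  drop-─ (suc n) (u ∷ U) (here _) = drop-one-drop n U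
  drop-─ (suc n) (u ∷ U) (there p) = drop-─ n U p

  ∈-take-─⁻ : (p : x ∈ U) → y ∈ take n (U ─ p) → y ∈ take (suc n) U
  ∈-take-─⁻ (here _) q = there q
  ∈-take-─⁻ {n = suc n} (there p) (here e) = here e
  ∈-take-─⁻ {n = suc n} (there p) (there q) = there (∈-take-─⁻ p q)

  ∈-take-─⁺ : (p : x ∈ U) → y ∈ take n U → y ≢ x → y ∈ take n (U ─ p)
  ∈-take-─⁺ {n = suc n} (here refl) (here refl) y≢x = ⊥-elim (y≢x refl)
  ∈-take-─⁺ {n = suc n} (here refl) (there q) _ = ∈-take-mono (ℕ.n≤1+n n) q
  ∈-take-─⁺ {n = suc n} (there p) (here e) _ = here e
  ∈-take-─⁺ {n = suc n} (there p) (there q) y≢x = there (∈-take-─⁺ p q y≢x)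

  ∈-take-suc-─⁺ : (p : x ∈ U) → toℕ (index p) ≤ n → y ∈ take (suc n) U → y ≢ x →
                  y ∈ take n (U ─ p)
  ∈-take-suc-─⁺ (here refl) _ (here refl) y≢x = ⊥-elim (y≢x refl)
  ∈-take-suc-─⁺ (here refl) _ (there q) _ = q
  ∈-take-suc-─⁺ {n = suc n} (there p) _ (here e) _ = here e
  ∈-take-suc-─⁺ {n = suc n} (there p) (s≤s i≤n) (there q) y≢x = there (∈-take-suc-─⁺ p i≤n q y≢x)

  ─-⊆ : ∀ {p} {P : A → Set p} (q : Any P U) → (U ─ q) ⊆ U
  ─-⊆ {U = u ∷ U} (here _) = u ∷ʳ ⊆-refl
  ─-⊆ {U = u ∷ U} (there q) = refl ∷ ─-⊆ q

  ∈-─⁻ : (p : x ∈ U) → y ∈ U → y ≡ x ⊎ y ∈ (U ─ p)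
  ∈-─⁻ (here refl) (here refl) = inj₁ refl
  ∈-─⁻ (here refl) (there q) = inj₂ q
  ∈-─⁻ (there p) (here e) = inj₂ (here e)
  ∈-─⁻ (there p) (there q) with ∈-─⁻ p q
  ... | inj₁ e = inj₁ e
  ... | inj₂ r = inj₂ (there r)

  -- The unwritten-element sequence U stands for the state: its first B elements are
  -- the buffer, and removing a written element from U also refills the freed slot.
  data MaxRun (B : ℕ) (d : Dir O) : Maybe A → List A → List A → List A → Set (a ⊔ ℓ₂) where
    stop  : (∀ {y} → y ∈ take B U → eligible O d last y ≡ false) → MaxRun B d last U [] U
    write : (x∈ : x ∈ take B U) → eligible O d last x ≡ true →
            (∀ {y} → y ∈ take B U → eligible O d last y ≡ true → ¬ y ≺[ d ] x) →
            MaxRun B d (just x) (U ─ ∈-take⁻ B U x∈) W V → MaxRun B d last U (x ∷ W) V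

  runFrom-maxRun : ∀ B k d last (U : List A) → length U ≤ k →
    ∃₂ λ W V → MaxRun B d last U W V ×
               runFrom O k d last (take B U) (drop B U) ≡ (W , take B V , drop B V)
  runFrom-maxRun B zero d last [] _ =
    [] , [] , stop (λ {y} p → ⊥-elim (¬Any[] (subst (y ∈_) (take-[] B) p))) , refl
  runFrom-maxRun B (suc k) d last U |U|≤k+1
    with extract O d (eligible O d last) (take B U) in eq
  ... | nothing = [] , U , stop (extract-nothing d _ (take B U) eq) , refl
  ... | just (x , ys) with extract-just d _ (take B U) eq
  ... | record { w∈xs = x∈ ; residue = refl ; chosen-p = el ; best = best }
    with runFrom-maxRun B k d (just x) (U ─ ∈-take⁻ B U x∈)
           (ℕ.≤-pred (subst (_≤ suc k) (length-removeAt′ U _) |U|≤k+1))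
  ... | W , V , run , eq′ rewrite take-─ B U x∈ | drop-─ B U x∈ | eq′ =
    x ∷ W , V , write x∈ el best run , refl

  maxRun-spec : ∀ d B U → ∃ λ V → MaxRun B d nothing U (maxRun O d B U) V
  maxRun-spec d B U with runFrom-maxRun B (length U) d nothing U ℕ.≤-refl
  ... | W , V , run , eq = V , subst (λ W → MaxRun B d nothing U W V) (sym (cong proj₁ eq)) run

  data Writes (M : ℕ) : List A → List A → List A → Set a where
    []    : Writes M U [] U
    write : (x∈ : x ∈ U) → toℕ (index x∈) < M → Writes M (U ─ x∈) R V → Writes M U (x ∷ R) V

  maxRun⇒writes : MaxRun B d last U W V → Writes B U W V
  maxRun⇒writes (stop _) = []
  maxRun⇒writes {B} {U = U} (write x∈ _ _ run) =
    write (∈-take⁻ B U x∈) (index-∈-take⁻ B U x∈) (maxRun⇒writes run)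

  writes-++⁻ : ∀ R → Writes M U (R ++ S) W → ∃ λ V → Writes M U R V × Writes M V S W
  writes-++⁻ [] w = _ , [] , w
  writes-++⁻ (x ∷ R) (write x∈ i<M w) with writes-++⁻ R w
  ... | V , w₁ , w₂ = V , write x∈ i<M w₁ , w₂

  writes-⊆ : Writes M U R V → V ⊆ U
  writes-⊆ [] = ⊆-refl
  writes-⊆ (write x∈ _ w) = ⊆-trans (writes-⊆ w) (─-⊆ x∈)

  writes-∈ : Writes M U R V → y ∈ R → y ∈ U
  writes-∈ (write x∈ _ w) (here refl) = x∈
  writes-∈ (write x∈ _ w) (there y∈R) = Any-resp-⊆ (─-⊆ x∈) (writes-∈ w y∈R)

  writes-∈⁻ : Writes M U R V → y ∈ U → y ∈ R ⊎ y ∈ V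
  writes-∈⁻ [] y∈U = inj₂ y∈U
  writes-∈⁻ (write x∈ _ w) y∈U with ∈-─⁻ x∈ y∈U
  ... | inj₁ refl = inj₁ (here refl)
  ... | inj₂ y∈U─x with writes-∈⁻ w y∈U─x
  ...   | inj₁ y∈R = inj₁ (there y∈R)
  ...   | inj₂ y∈V = inj₂ y∈V

  writes-shrinks : Writes M U R V → y ∈ R → length V < length U
  writes-shrinks {U = U} {V = V} (write x∈ _ w) _ =
    subst (length V <_) (sym (length-removeAt′ U (index x∈))) (s≤s (length-mono-≤ (writes-⊆ w)))

  -- A necessary condition for R to be writable, in order, with a buffer of n slots.
  data Timely : ℕ → List A → List A → Set a where
    []  : Timely n U []
    _∷_ : y ∈ take n U → Timely (suc n) U R → Timely n U (y ∷ R)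

  timely-mono : ∀ {m} → n ≤ m → Timely n U R → Timely m U R
  timely-mono n≤m [] = []
  timely-mono n≤m (y∈ ∷ t) = ∈-take-mono n≤m y∈ ∷ timely-mono (s≤s n≤m) t

  timely-─⁻ : (p : x ∈ U) → Timely n (U ─ p) R → Timely (suc n) U R
  timely-─⁻ p [] = []
  timely-─⁻ p (y∈ ∷ t) = ∈-take-─⁻ p y∈ ∷ timely-─⁻ p t

  timely-─⁺ : (p : x ∈ U) → All (_≢ x) R → Timely n U R → Timely n (U ─ p) R
  timely-─⁺ p [] [] = []
  timely-─⁺ p (y≢x ∷ ≢s) (y∈ ∷ t) = ∈-take-─⁺ p y∈ y≢x ∷ timely-─⁺ p ≢s t

  timely-suc-─⁺ : (p : x ∈ U) → toℕ (index p) ≤ n → All (_≢ x) R →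
                  Timely (suc n) U R → Timely n (U ─ p) R
  timely-suc-─⁺ p i≤n [] [] = []
  timely-suc-─⁺ p i≤n (y≢x ∷ ≢s) (y∈ ∷ t) =
    ∈-take-suc-─⁺ p i≤n y∈ y≢x ∷ timely-suc-─⁺ p (ℕ.m≤n⇒m≤1+n i≤n) ≢s t

  writes⇒timely : Writes M U R V → Timely M U R
  writes⇒timely [] = []
  writes⇒timely (write x∈ i<M w) = ∈-take⁺ x∈ i<M ∷ timely-─⁻ x∈ (writes⇒timely w)

  timely-within : ∀ k → Timely n U R → length R ≤ suc k → All (_∈ take (n + k) U) R
  timely-within k [] _ = []
  timely-within {n} zero (y∈ ∷ []) _ = ∈-take-mono (ℕ.m≤m+n n 0) y∈ ∷ []
  timely-within zero (_ ∷ _ ∷ _) (s≤s ())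
  timely-within {n} {U} (suc k) (y∈ ∷ t) (s≤s |R|≤k+1) =
    ∈-take-mono (ℕ.m≤m+n n (suc k)) y∈ ∷
    All.map (∈-take-mono (ℕ.≤-reflexive (sym (ℕ.+-suc n k)))) (timely-within k t |R|≤k+1)

  -- Maximal runs write every timely sequence in their direction

  Distinct : List A → Set (a ⊔ ℓ₁)
  Distinct = Unique ≈.setoid

  AllPairs-resp-⊆ : ∀ {r} {P : A → A → Set r} → V ⊆ U → AllPairs P U → AllPairs P V
  AllPairs-resp-⊆ [] [] = []
  AllPairs-resp-⊆ (_ ∷ʳ τ) (_ ∷ ps) = AllPairs-resp-⊆ τ ps
  AllPairs-resp-⊆ (refl ∷ τ) (p ∷ ps) = All-resp-⊆ τ p ∷ AllPairs-resp-⊆ τ ps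

  distinct-≈⇒≡ : Distinct U → x ∈ U → y ∈ U → x ≈ y → x ≡ y
  distinct-≈⇒≡ (_ ∷ _) (here refl) (here refl) _ = refl
  distinct-≈⇒≡ (x≉ ∷ _) (here refl) (there y∈) x≈y = ⊥-elim (All.lookup x≉ y∈ x≈y)
  distinct-≈⇒≡ (y≉ ∷ _) (there x∈) (here refl) x≈y = ⊥-elim (All.lookup y≉ x∈ (≈.sym x≈y))
  distinct-≈⇒≡ (_ ∷ uq) (there x∈) (there y∈) x≈y = distinct-≈⇒≡ uq x∈ y∈ x≈y

  distinct-─-≉ : Distinct U → (p : x ∈ U) → y ∈ (U ─ p) → ¬ y ≈ x
  distinct-─-≉ (x≉ ∷ _) (here refl) y∈ y≈x = All.lookup x≉ y∈ (≈.sym y≈x)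
  distinct-─-≉ (y≉ ∷ _) (there p) (here refl) y≈x = All.lookup y≉ p y≈x
  distinct-─-≉ (_ ∷ uq) (there p) (there y∈) y≈x = distinct-─-≉ uq p y∈ y≈x

  distinct-─ : Distinct U → (p : x ∈ U) → Distinct (U ─ p)
  distinct-─ uq p = AllPairs-resp-⊆ (─-⊆ p) uq

  writes-distinct : Writes M U R V → Distinct U → Distinct R
  writes-distinct [] _ = []
  writes-distinct (write x∈ _ w) uq =
    All.tabulate (λ y∈R x≈y → distinct-─-≉ uq x∈ (writes-∈ w y∈R) (≈.sym x≈y))
    ∷ writes-distinct w (distinct-─ uq x∈)

  writes-disjoint : Writes M U R V → Distinct U → y ∈ R → y ∈ V → ⊥
  writes-disjoint (write x∈ _ w) uq (here refl) y∈V =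
    distinct-─-≉ uq x∈ (Any-resp-⊆ (writes-⊆ w) y∈V) ≈.refl
  writes-disjoint (write x∈ _ w) uq (there y∈R) y∈V =
    writes-disjoint w (distinct-─ uq x∈) y∈R y∈V

  ≺⇒≢ : ∀ d → x ≺[ d ] y → y ≢ x
  ≺⇒≢ d x≺y refl = ≺-irrefl d x≺y ≈.refl

  maxRun-covers : MaxRun B d last U W V → Distinct U → AllPairs (_≺[ d ]_) R →
                  All (λ r → eligible O d last r ≡ true) R → Timely B U R → All (_∈ W) R
  maxRun-covers run uq ap els [] = []
  maxRun-covers (stop none) uq ap (el ∷ _) (r∈ ∷ _) with () ← trans (sym (none r∈)) el
  maxRun-covers {B} {d} {U = U} (write {x = x} x∈ _ best run) uq (r≺R ∷ ap) (el ∷ els) (_∷_ {y = r} r∈ t)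
    with ≺-trichotomous d x r
  ... | inj₂ (inj₂ r≺x) = ⊥-elim (best r∈ el r≺x)
  ... | inj₁ x≈r with refl ← distinct-≈⇒≡ uq (∈-take⁻ B U x∈) (∈-take⁻ B U r∈) x≈r =
    here refl ∷ All.map there
      (maxRun-covers run (distinct-─ uq _) ap (All.map (before-complete d) r≺R)
        (timely-suc-─⁺ _ (ℕ.<⇒≤ (index-∈-take⁻ B U x∈)) (All.map (≺⇒≢ d) r≺R) t))
  ... | inj₂ (inj₁ x≺r) = All.map there
      (maxRun-covers run (distinct-─ uq _) (r≺R ∷ ap) (All.map (before-complete d) x≺R)
        (timely-─⁺ _ (All.map (≺⇒≢ d) x≺R) (r∈ ∷ t)))
    where
    x≺R : All (x ≺[ d ]_) (r ∷ _)
    x≺R = x≺r ∷ All.map (≺-trans d x≺r) r≺R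

  maxRun-writes-buffer : MaxRun B d nothing U W V → Distinct U → x ∈ take B U → x ∈ W
  maxRun-writes-buffer run uq x∈ = All.head (maxRun-covers run uq ([] ∷ []) (refl ∷ []) (x∈ ∷ []))

  -- Two runs in opposite directions

  open import Data.List.Membership.DecSetoid ≈.decSetoid
    using () renaming (_∈_ to _∈ₛ_; _∈?_ to _∈ₛ?_; _∉?_ to _∉ₛ?_)

  ∈⇒∈ₛ : x ∈ U → x ∈ₛ U
  ∈⇒∈ₛ = Any.map λ { refl → ≈.refl }

  ∈ₛ-─⁺ : (p : x ∈ₛ U) → y ∈ₛ U → ¬ y ≈ x → y ∈ₛ (U ─ p)
  ∈ₛ-─⁺ (here u≈x) (here u≈y) y≉x = ⊥-elim (y≉x (≈.trans u≈y (≈.sym u≈x)))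
  ∈ₛ-─⁺ (here _) (there q) _ = q
  ∈ₛ-─⁺ (there p) (here u≈y) _ = here u≈y
  ∈ₛ-─⁺ (there p) (there q) y≉x = there (∈ₛ-─⁺ p q y≉x)

  distinct-length-≤ : Distinct R → All (_∈ₛ U) R → length R ≤ length U
  distinct-length-≤ [] [] = z≤n
  distinct-length-≤ {U = U} (x≉R ∷ uq) (x∈U ∷ R⊆U) =
    subst (_ ≤_) (sym (length-removeAt′ U (index x∈U)))
      (s≤s (distinct-length-≤ uq
        (All.zipWith (λ (x≉y , y∈U) → ∈ₛ-─⁺ x∈U y∈U (x≉y ∘ ≈.sym)) (x≉R , R⊆U))))

  timely-take : ∀ k → Timely n U R → Timely n U (take k R)
  timely-take zero _ = []
  timely-take (suc k) [] = []
  timely-take (suc k) (y∈ ∷ t) = y∈ ∷ timely-take k t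

  length-take-≤ : ∀ k (R : List A) → length (take k R) ≤ k
  length-take-≤ k R = ℕ.≤-trans (ℕ.≤-reflexive (length-take k R)) (ℕ.m⊓n≤m k _)

  length-take-≡ : ∀ k (R : List A) → k ≤ length R → length (take k R) ≡ k
  length-take-≡ k R k≤|R| = trans (length-take k R) (ℕ.m≤n⇒m⊓n≡m k≤|R|)

  timely-complement-length-≤ : Distinct U → Distinct R → Timely n U R →
    length (filter (_∉ₛ? R) (take (n + length R) U)) ≤ n
  timely-complement-length-≤ {U = U} {R} {n} uq uR t = ℕ.+-cancelˡ-≤ (length R) _ _ (begin
    length R + length F   ≡⟨ sym (length-++ R) ⟩
    length (R ++ F)       ≤⟨ distinct-length-≤ distinct-R++F (All.map ∈⇒∈ₛ (++⁺ R⊆X F⊆X)) ⟩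
    length X              ≤⟨ length-take-≤ (n + length R) U ⟩
    n + length R          ≡⟨ ℕ.+-comm n _ ⟩
    length R + n          ∎)
    where
    open ℕ.≤-Reasoning
    X F : List A
    X = take (n + length R) U
    F = filter (_∉ₛ? R) X
    R⊆X : All (_∈ X) R
    R⊆X = timely-within (length R) t (ℕ.n≤1+n _)
    F⊆X : All (_∈ X) F
    F⊆X = All.tabulate (λ z∈F → proj₁ (∈-filter⁻ (_∉ₛ? R) {xs = X} z∈F))
    distinct-R++F : Distinct (R ++ F)
    distinct-R++F = Unique.++⁺ ≈.setoid uR
      (Unique.filter⁺ ≈.setoid (_∉ₛ? R) {X} (Unique.take⁺ ≈.setoid (n + length R) uq))
      λ (v∈R , v∈F) → let (f , f∈F , v≈f) = find v∈F in
        proj₂ (∈-filter⁻ (_∉ₛ? R) {xs = X} f∈F) (∈-resp-≈ ≈.setoid v≈f v∈R)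

  sorted⇒distinct : ∀ d → AllPairs (_≺[ d ]_) R → Distinct R
  sorted⇒distinct d = AllPairs.map (≺-irrefl d)

  ∈-take⇒split : ∀ k (R : List A) → y ∈ take k R → ∃₂ λ R₁ R₂ → R ≡ R₁ ++ y ∷ R₂ × length R₁ < k
  ∈-take⇒split (suc k) (r ∷ R) (here refl) = [] , R , refl , s≤s z≤n
  ∈-take⇒split (suc k) (r ∷ R) (there y∈) with ∈-take⇒split k R y∈
  ... | R₁ , R₂ , refl , |R₁|<k = r ∷ R₁ , R₂ , refl , s≤s |R₁|<k

  AllPairs-take-drop : ∀ {r} {P : A → A → Set r} k → AllPairs P R → x ∈ take k R → z ∈ drop k R → P x z
  AllPairs-take-drop {R = r ∷ R} (suc k) (px ∷ _) (here refl) z∈ =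
    All.lookup px (Any-resp-⊆ (drop-⊆ k R) z∈)
  AllPairs-take-drop {R = r ∷ R} (suc k) (_ ∷ ps) (there x∈) z∈ = AllPairs-take-drop k ps x∈ z∈

  AllPairs-middle : ∀ {r} {P : A → A → Set r} R₁ {R₂} → AllPairs P (R₁ ++ y ∷ R₂) → All (P y) R₂
  AllPairs-middle [] (py ∷ _) = py
  AllPairs-middle (_ ∷ R₁) (_ ∷ ps) = AllPairs-middle R₁ ps

  -- Otherwise 2M distinct elements would fit into the first M + (M - 1) unwritten ones.
  prefixes-meet : ∀ {m P} → let M = suc m in
    Distinct U → Distinct P → Distinct R → Timely M U P → Timely M U R →
    M ≤ length P → M ≤ length R → ∃ λ x → x ∈ take M P × x ∈ₛ take M R
  prefixes-meet {U = U} {R} {m} {P} uq uP uR tP tR M≤|P| M≤|R|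
    with Any.any? (_∈ₛ? take (suc m) R) (take (suc m) P)
  ... | yes meet = find meet
  ... | no disjoint = ⊥-elim (ℕ.<-irrefl refl (ℕ.+-cancelˡ-≤ (suc m) _ _ (begin
    suc m + suc m               ≡⟨ sym (cong₂ _+_ (length-take-≡ _ P M≤|P|) (length-take-≡ _ R M≤|R|)) ⟩
    length P′ + length R′       ≡⟨ sym (length-++ P′) ⟩
    length (P′ ++ R′)           ≤⟨ distinct-length-≤ distinct-P′R′
                                     (All.map ∈⇒∈ₛ (++⁺ (within tP M≤|P|) (within tR M≤|R|))) ⟩
    length (take (suc m + m) U) ≤⟨ length-take-≤ (suc m + m) U ⟩
    suc m + m                   ∎)))
    where
    open ℕ.≤-Reasoning
    P′ R′ : List A
    P′ = take (suc m) P
    R′ = take (suc m) R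
    within : ∀ {S} → Timely (suc m) U S → suc m ≤ length S →
             All (_∈ take (suc m + m) U) (take (suc m) S)
    within {S} t M≤|S| =
      timely-within m (timely-take (suc m) t) (ℕ.≤-reflexive (length-take-≡ _ S M≤|S|))
    distinct-P′R′ : Distinct (P′ ++ R′)
    distinct-P′R′ = Unique.++⁺ ≈.setoid (Unique.take⁺ ≈.setoid _ uP) (Unique.take⁺ ≈.setoid _ uR)
      λ (v∈P′ , v∈R′) → let (p , p∈P′ , v≈p) = find v∈P′ in
        disjoint (lose p∈P′ (∈-resp-≈ ≈.setoid v≈p v∈R′))

  -- Past position M, P holds only elements beyond x, which R can contain only before x,
  -- i.e. in R₁; the others lie outside R, and only M of the first M + |R| elements do.
  meeting-bound : ∀ {P} → Distinct U → AllPairs (_≺[ d ]_) P → Timely M U P →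
    AllPairs (_≺[ opposite d ]_) R → Timely M U R → length R ≤ length P →
    x ∈ take M P → x ∈ₛ take M R → length R ≤ 3 * M
  meeting-bound {U = U} {d} {M} {R} {x} {P} uq sP tP sR tR |R|≤|P| x∈P′ x∈ₛR′
    with y , y∈R′ , x≈y ← find x∈ₛR′
    with R₁ , R₂ , refl , |R₁|<M ← ∈-take⇒split M R y∈R′ = begin
    ℓ                           ≤⟨ ℕ.m≤n+m∸n ℓ M ⟩
    M + (ℓ ∸ M)                 ≡⟨ cong (λ k → M + (k ∸ M)) (sym (length-take-≡ ℓ P |R|≤|P|)) ⟩
    M + (length (take ℓ P) ∸ M) ≡⟨ cong (M +_) (sym (length-drop M (take ℓ P))) ⟩
    M + length Y                ≤⟨ ℕ.+-monoʳ-≤ M (distinct-length-≤ distinct-Y Y⊆R₁++F) ⟩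
    M + length (R₁ ++ F)        ≡⟨ cong (M +_) (length-++ R₁) ⟩
    M + (length R₁ + length F)  ≤⟨ ℕ.+-monoʳ-≤ M (ℕ.+-mono-≤ (ℕ.<⇒≤ |R₁|<M)
                                     (timely-complement-length-≤ uq (sorted⇒distinct (opposite d) sR) tR)) ⟩
    M + (M + M)                 ≡⟨ cong (λ k → M + (M + k)) (sym (ℕ.+-identityʳ M)) ⟩
    3 * M                       ∎
    where
    open ℕ.≤-Reasoning
    ℓ : ℕ
    ℓ = length R
    Y F : List A
    Y = drop M (take ℓ P)
    F = filter (_∉ₛ? R) (take (M + ℓ) U)
    Y⊆P : Y ⊆ P
    Y⊆P = ⊆-trans (drop-⊆ M (take ℓ P)) (take-⊆ ℓ P)
    distinct-Y : Distinct Y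
    distinct-Y = AllPairs-resp-⊆ Y⊆P (sorted⇒distinct d sP)
    y≺Y : All (y ≺[ d ]_) Y
    y≺Y = All.tabulate λ z∈Y → ≺-respˡ-≈ d x≈y
      (AllPairs-take-drop M sP x∈P′ (Any-resp-⊆ (HP.drop⁺-⊆ M (take-⊆ ℓ P)) z∈Y))
    R₂≺y : All (_≺[ d ] y) R₂
    R₂≺y = All.map (≺-opposite d) (AllPairs-middle R₁ sR)
    y∷R₂-excludes : ∀ {z} → y ≺[ d ] z → ¬ z ∈ₛ (y ∷ R₂)
    y∷R₂-excludes y≺z (here z≈y) = ≺-irrefl d y≺z (≈.sym z≈y)
    y∷R₂-excludes y≺z (there z∈R₂) = let (w , w∈R₂ , z≈w) = find z∈R₂ in
      ≺-irrefl d (≺-trans d (All.lookup R₂≺y w∈R₂) y≺z) (≈.sym z≈w)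
    Y-within : All (_∈ take (M + ℓ) U) Y
    Y-within = All-resp-⊆ (drop-⊆ M (take ℓ P))
      (timely-within ℓ (timely-take ℓ tP) (ℕ.≤-trans (length-take-≤ ℓ P) (ℕ.n≤1+n ℓ)))
    Y⊆R₁++F : All (_∈ₛ R₁ ++ F) Y
    Y⊆R₁++F = All.tabulate λ {z} z∈Y → case z ∈ₛ? R of λ where
      (no z∉R)  → AnyP.++⁺ʳ R₁ (∈⇒∈ₛ (∈-filter⁺ (_∉ₛ? R) (All.lookup Y-within z∈Y) z∉R))
      (yes z∈R) → case AnyP.++⁻ R₁ z∈R of λ where
        (inj₁ z∈R₁)   → AnyP.++⁺ˡ z∈R₁
        (inj₂ z∈y∷R₂) → ⊥-elim (y∷R₂-excludes (All.lookup y≺Y z∈Y) z∈y∷R₂)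

  opposite-run-within : ∀ {m P} → Distinct U → AllPairs (_≺[ d ]_) P → Timely (suc m) U P →
    AllPairs (_≺[ opposite d ]_) R → Timely (suc m) U R → length R ≤ length P →
    All (_∈ take (4 * suc m) U) R
  opposite-run-within {U = U} {d} {R} {m} {P} uq sP tP sR tR |R|≤|P| =
    timely-within (3 * suc m) tR (ℕ.m≤n⇒m≤1+n |R|≤3M)
    where
    |R|≤3M : length R ≤ 3 * suc m
    |R|≤3M with suc m ℕ.≤? length R
    ... | no M≰|R| = ℕ.≤-trans (ℕ.<⇒≤ (ℕ.≰⇒> M≰|R|)) (ℕ.m≤m+n (suc m) _)
    ... | yes M≤|R|
      with x , x∈P′ , x∈ₛR′ ← prefixes-meet uq (sorted⇒distinct d sP) (sorted⇒distinct (opposite d) sR)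
                                tP tR (ℕ.≤-trans M≤|R| |R|≤|P|) M≤|R|
      = meeting-bound {d = d} uq sP tP sR tR |R|≤|P| x∈P′ x∈ₛR′

  -- Outputs split into runs

  ⊑-trans : x NonStrict.≤ y → y NonStrict.≤ z → x NonStrict.≤ z
  ⊑-trans = NonStrict.trans ≈.isEquivalence <.<-resp-≈ <.trans

  IsRun-resp-⊆ : V ⊆ U → IsRun O U → IsRun O V
  IsRun-resp-⊆ τ (inj₁ asc) =
    inj₁ (AllPairs⇒Linked (AllPairs-resp-⊆ τ (Linked⇒AllPairs ⊑-trans asc)))
  IsRun-resp-⊆ τ (inj₂ desc) =
    inj₂ (AllPairs⇒Linked (AllPairs-resp-⊆ τ (Linked⇒AllPairs (flip ⊑-trans) desc)))

  ⊆-++⁻ : ∀ R₁ {R₂} → S ⊆ R₁ ++ R₂ → ∃₂ λ S₁ S₂ → S ≡ S₁ ++ S₂ × S₁ ⊆ R₁ × S₂ ⊆ R₂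
  ⊆-++⁻ [] τ = [] , _ , refl , [] , τ
  ⊆-++⁻ (r ∷ R₁) (.r ∷ʳ τ) with S₁ , S₂ , refl , τ₁ , τ₂ ← ⊆-++⁻ R₁ τ =
    S₁ , S₂ , refl , r ∷ʳ τ₁ , τ₂
  ⊆-++⁻ (r ∷ R₁) (refl ∷ τ) with S₁ , S₂ , refl , τ₁ , τ₂ ← ⊆-++⁻ R₁ τ =
    r ∷ S₁ , S₂ , refl , refl ∷ τ₁ , τ₂

  runs-resp-⊆ : ∀ Ls → S ⊆ concat Ls → All (IsRun O) Ls →
    ∃ λ Ls′ → length Ls′ ≡ length Ls × concat Ls′ ≡ S × All (IsRun O) Ls′
  runs-resp-⊆ [] [] [] = [] , refl , refl , []
  runs-resp-⊆ (L ∷ Ls) τ (run ∷ runs)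
    with S₁ , S₂ , refl , τ₁ , τ₂ ← ⊆-++⁻ L τ
    with Ls′ , |Ls′| , refl , runs′ ← runs-resp-⊆ Ls τ₂ runs
    = S₁ ∷ Ls′ , cong suc |Ls′| , refl , IsRun-resp-⊆ τ₁ run ∷ runs′

  linked-strict : ∀ {r s} {_∼_ : A → A → Set r} {_≺_ : A → A → Set s} →
    (∀ {x y} → ¬ x ≈ y → x ∼ y → x ≺ y) → Distinct R → Linked _∼_ R → Linked _≺_ R
  linked-strict strict _ [] = []
  linked-strict strict _ [-] = [-]
  linked-strict strict ((x≉y ∷ _) ∷ uq) (x∼y ∷ l) = strict x≉y x∼y ∷ linked-strict strict uq l

  run-sorted : Distinct R → IsRun O R → ∃ λ d → AllPairs (_≺[ d ]_) R
  run-sorted uq (inj₁ asc) = up , Linked⇒AllPairs (≺-trans up)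
    (linked-strict (λ { _ (inj₁ x⊏y) → x⊏y ; x≉y (inj₂ x≈y) → ⊥-elim (x≉y x≈y) }) uq asc)
  run-sorted uq (inj₂ desc) = down , Linked⇒AllPairs (≺-trans down)
    (linked-strict (λ { _ (inj₁ y⊏x) → y⊏x ; x≉y (inj₂ y≈x) → ⊥-elim (x≉y (≈.sym y≈x)) }) uq desc)

  exec⇒writes : ∀ {buf rest} → Exec O buf rest S → buf ≡ take M U → rest ≡ drop M U → Writes M U S []
  exec⇒writes {U = []} done _ _ = []
  exec⇒writes {M = zero} {U = _ ∷ _} done _ ()
  exec⇒writes {M = suc M} {U = _ ∷ _} done () _
  exec⇒writes {M = M} {U = U} (write x∈ ex) refl refl =
    write (∈-take⁻ M U x∈) (index-∈-take⁻ M U x∈) (exec⇒writes ex (take-─ M U x∈) (drop-─ M U x∈))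

  ─-⊆-─ : (τ : V ⊆ U) (p : x ∈ U) →
    (∃ λ (q : x ∈ V) → toℕ (index q) ≤ toℕ (index p) × (V ─ q) ⊆ (U ─ p)) ⊎ V ⊆ (U ─ p)
  ─-⊆-─ (_ ∷ʳ τ) (here refl) = inj₂ τ
  ─-⊆-─ (u ∷ʳ τ) (there p) with ─-⊆-─ τ p
  ... | inj₁ (q , i≤j , σ) = inj₁ (q , ℕ.m≤n⇒m≤1+n i≤j , u ∷ʳ σ)
  ... | inj₂ σ = inj₂ (u ∷ʳ σ)
  ─-⊆-─ (refl ∷ τ) (here refl) = inj₁ (here refl , z≤n , τ)
  ─-⊆-─ (refl ∷ τ) (there p) with ─-⊆-─ τ p
  ... | inj₁ (q , i≤j , σ) = inj₁ (there q , s≤s i≤j , refl ∷ σ)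
  ... | inj₂ σ = inj₂ (refl ∷ σ)

  writes-resp-⊆ : V ⊆ U → Writes M U S [] → ∃ λ S′ → Writes M V S′ [] × S′ ⊆ S
  writes-resp-⊆ [] [] = [] , [] , []
  writes-resp-⊆ τ (write {x = x} p i<M w) with ─-⊆-─ τ p
  ... | inj₁ (q , i≤j , σ) with S′ , w′ , S′⊆S ← writes-resp-⊆ σ w =
    x ∷ S′ , write q (ℕ.≤-<-trans i≤j i<M) w′ , refl ∷ S′⊆S
  ... | inj₂ σ with S′ , w′ , S′⊆S ← writes-resp-⊆ σ w = S′ , w′ , x ∷ʳ S′⊆S

  subsets-⊆ : Distinct U → V ⊆ U → W ⊆ U → (∀ {x} → x ∈ V → x ∈ W) → V ⊆ W
  subsets-⊆ [] [] [] _ = []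
  subsets-⊆ (_ ∷ uq) (u ∷ʳ τ) (.u ∷ʳ σ) V⊆W = subsets-⊆ uq τ σ V⊆W
  subsets-⊆ (u≉ ∷ uq) (u ∷ʳ τ) (refl ∷ σ) V⊆W =
    u ∷ʳ subsets-⊆ uq τ σ λ x∈V → case V⊆W x∈V of λ where
      (here refl) → ⊥-elim (All.lookup u≉ (Any-resp-⊆ τ x∈V) ≈.refl)
      (there x∈W) → x∈W
  subsets-⊆ (u≉ ∷ uq) (refl ∷ τ) (u ∷ʳ σ) V⊆W =
    ⊥-elim (All.lookup u≉ (Any-resp-⊆ σ (V⊆W (here refl))) ≈.refl)
  subsets-⊆ (u≉ ∷ uq) (refl ∷ τ) (refl ∷ σ) V⊆W =
    refl ∷ subsets-⊆ uq τ σ λ x∈V → case V⊆W (there x∈V) of λ where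
      (here refl) → ⊥-elim (All.lookup u≉ (Any-resp-⊆ τ x∈V) ≈.refl)
      (there x∈W) → x∈W

  -- Algorithm A

  chooseDir-longer : ∀ M U →
    length (maxRun O (opposite (chooseDir O M U)) M U) ≤ length (maxRun O (chooseDir O M U) M U)
  chooseDir-longer M U with length (maxRun O down M U) <ᵇ length (maxRun O up M U) in lt
  ... | true  = ℕ.<⇒≤ (ℕ.<ᵇ⇒< _ _ (subst T (sym lt) _))
  ... | false = ℕ.≮⇒≥ (λ d<u → subst T lt (ℕ.<⇒<ᵇ d<u))

  maxRun-sorted : MaxRun B d last U W V → AllPairs (_≺[ d ]_) W
  maxRun-sorted {d = d} run = Linked⇒AllPairs (≺-trans d) (linked run)
    where
    linked : MaxRun B d last U W V → Linked (_≺[ d ]_) W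
    linked (stop _) = []
    linked (write _ _ _ (stop _)) = [-]
    linked (write _ _ _ run@(write _ el _ _)) = before-sound d el ∷ linked run

  same-or-opposite : ∀ d′ d → d′ ≡ d ⊎ d′ ≡ opposite d
  same-or-opposite up   up   = inj₁ refl
  same-or-opposite up   down = inj₂ refl
  same-or-opposite down up   = inj₂ refl
  same-or-opposite down down = inj₁ refl

  first-run-covers : ∀ {m R₁ U₁} → let M = suc m in
    MaxRun (4 * M) (chooseDir O M U) nothing U W V → Distinct U →
    Writes M U R₁ U₁ → IsRun O R₁ → All (_∈ W) R₁
  first-run-covers {U = U} {m = m} {R₁} run uq w isRun
    with dR , sR ← run-sorted (writes-distinct w uq) isRun
    with same-or-opposite dR (chooseDir O (suc m) U)
  ... | inj₁ refl = maxRun-covers run uq sR (All.tabulate λ _ → refl)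
                      (timely-mono (ℕ.m≤m+n (suc m) _) (writes⇒timely w))
  ... | inj₂ refl = All.map (maxRun-writes-buffer run uq) R₁-within
    where
    dA : Dir O
    dA = chooseDir O (suc m) U
    P R̄ : List A
    P = maxRun O dA (suc m) U
    R̄ = maxRun O (opposite dA) (suc m) U
    P-run : MaxRun (suc m) dA nothing U P (proj₁ (maxRun-spec dA (suc m) U))
    P-run = proj₂ (maxRun-spec dA (suc m) U)
    R₁⊆R̄ : All (_∈ R̄) R₁
    R₁⊆R̄ = maxRun-covers (proj₂ (maxRun-spec (opposite dA) (suc m) U)) uq sR
              (All.tabulate λ _ → refl) (writes⇒timely w)
    |R₁|≤|P| : length R₁ ≤ length P
    |R₁|≤|P| = ℕ.≤-trans (distinct-length-≤ (writes-distinct w uq) (All.map ∈⇒∈ₛ R₁⊆R̄))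
                          (chooseDir-longer (suc m) U)
    R₁-within : All (_∈ take (4 * suc m) U) R₁
    R₁-within = opposite-run-within {d = dA} uq
                  (maxRun-sorted P-run) (writes⇒timely (maxRun⇒writes P-run)) sR (writes⇒timely w) |R₁|≤|P|

  residue-⊆ : Distinct U → Writes B U W V → Writes M U R U′ → All (_∈ W) R → V ⊆ U′
  residue-⊆ uq wW wR R⊆W = subsets-⊆ uq (writes-⊆ wW) (writes-⊆ wR) λ x∈V →
    case writes-∈⁻ wR (Any-resp-⊆ (writes-⊆ wW) x∈V) of λ where
      (inj₁ x∈R)  → ⊥-elim (writes-disjoint wW uq (All.lookup R⊆W x∈R) x∈V)
      (inj₂ x∈U′) → x∈U′

  algLoop-unfold : ∀ M f b buf rest {W buf′ rest′} →
    runFrom O (length ((b ∷ buf) ++ rest)) (chooseDir O M ((b ∷ buf) ++ rest)) nothing (b ∷ buf) rest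
      ≡ (W , buf′ , rest′) →
    algLoop O M (suc f) (b ∷ buf) rest ≡ W ∷ algLoop O M f buf′ rest′
  algLoop-unfold M f b buf rest eq rewrite eq = refl

  algLoop-step : ∀ m f u (U : List A) →
    ∃₂ λ W V → MaxRun (4 * suc m) (chooseDir O (suc m) (u ∷ U)) nothing (u ∷ U) W V ×
      algLoop O (suc m) (suc f) (take (4 * suc m) (u ∷ U)) (drop (4 * suc m) (u ∷ U))
        ≡ W ∷ algLoop O (suc m) f (take (4 * suc m) V) (drop (4 * suc m) V)
  algLoop-step m f u U
    with W , V , run , eq ← runFrom-maxRun (4 * suc m) (length (u ∷ U)) (chooseDir O (suc m) (u ∷ U))
                                           nothing (u ∷ U) ℕ.≤-refl
    = W , V , run , algLoop-unfold (suc m) f u (take _ U) (drop K (u ∷ U))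
                      (subst ComputesRun (sym (take++drop≡id K (u ∷ U))) eq)
    where
    K : ℕ
    K = 4 * suc m
    ComputesRun : List A → Set a
    ComputesRun Z =
      runFrom O (length Z) (chooseDir O (suc m) Z) nothing (take K (u ∷ U)) (drop K (u ∷ U))
        ≡ (W , take K V , drop K V)

  algLoop-[] : ∀ M f (rest : List A) → algLoop O M f [] rest ≡ []
  algLoop-[] M zero rest = refl
  algLoop-[] M (suc f) rest = refl

  algLoop-optimal : ∀ f → length U < f → Distinct U → ∀ Ls →
    Writes M U (concat Ls) [] → All (IsRun O) Ls →
    length (algLoop O M f (take (4 * M) U) (drop (4 * M) U)) ≤ length Ls
  algLoop-optimal {M = M} f _ _ [] [] [] = ℕ.≤-reflexive (cong length
    (trans (cong (λ buf → algLoop O M f buf (drop (4 * M) [])) (take-[] (4 * M))) (algLoop-[] M f _)))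
  algLoop-optimal f |U|<f uq ([] ∷ Ls) w (_ ∷ runs) = ℕ.m≤n⇒m≤1+n (algLoop-optimal f |U|<f uq Ls w runs)
  algLoop-optimal f |U|<f uq ((r ∷ R) ∷ Ls) w (isRun ∷ runs) with writes-++⁻ (r ∷ R) w
  algLoop-optimal {M = zero} _ _ _ _ _ _ | _ , write _ () _ , _
  algLoop-optimal {[]} _ _ _ _ _ _ | _ , write () _ _ , _
  algLoop-optimal {u ∷ U} {suc m} (suc f) (s≤s |U|<f) uq ((r ∷ R) ∷ Ls) w (isRun ∷ runs) | U₁ , w₁ , w′
    with W , V , run , step ← algLoop-step m f u U
    with r∈W ∷ R⊆W ← first-run-covers run uq w₁ isRun
    with S′ , w″ , S′⊆ ← writes-resp-⊆ (residue-⊆ uq (maxRun⇒writes run) w₁ (r∈W ∷ R⊆W)) w′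
    with Ls′ , |Ls′| , refl , runs′ ← runs-resp-⊆ Ls S′⊆ runs
    = ℕ.≤-trans (ℕ.≤-reflexive (cong length step)) (s≤s (subst (_ ≤_) |Ls′|
      (algLoop-optimal f (ℕ.<-≤-trans (writes-shrinks (maxRun⇒writes run) r∈W) |U|<f)
        (AllPairs-resp-⊆ (writes-⊆ (maxRun⇒writes run)) uq) Ls′ w″ runs′)))

theorem7 : ∀ {a ℓ₁ ℓ₂ : Level} (O : StrictTotalOrder a ℓ₁ ℓ₂) (M : ℕ) I →
    Unique (StrictTotalOrder.Eq.setoid O) I →
    _≤OPT[_]_ O (length (runsOfA O M I)) M I
theorem7 O M I distinct S achievable k (Ls , |Ls|≡k , refl , runs) =
  subst (_ ≤_) |Ls|≡k
    (algLoop-optimal (suc (length I)) ℕ.≤-refl distinct Ls (exec⇒writes achievable refl refl) runs)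
  where open UpDownRuns O
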